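{- For every $n \ge 0$, the binary word $101$ has an internal zero at $n$ if and only if $n = 6$.
   Context: A binary word is a finite sequence over $\{0,1\}$. An occurrence of $p = p_1\cdots p_l$ in $w = w_1\cdots w_n$ is a choice of indices $1 \le i_1 < \cdots < i_l \le n$ with $w_{i_1}\cdots w_{i_l} = p$; $c_p(w)$ is the number of occurrences, and $B_{n,p}(k)$ is the number of binary words $w$ of length $n$ with $c_p(w)=k$. The word $p$ has an internal zero at $n$ if there exist $0 \le k_1 < k_2 < k_3$ with $B_{n,p}(k_1) \ne 0$, $B_{n,p}(k_3) \ne 0$ and $B_{n,p}(k_2) = 0$. -}

module Defs where

open import Data.Bool using (Bool; true; false; if_then_else_)
open import Data.Bool.Properties using () renaming (_≟_ to _≟ᵇ_)
open import Data.Nat using (ℕ; zero; suc; _+_; _<_)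
open import Data.List using (List; []; _∷_; map; _++_; length; filter)
open import Data.Nat.Properties using (_≟_)
open import Data.Product using (Σ; _×_; ∃-syntax)
open import Relation.Binary.PropositionalEquality using (_≡_)
open import Relation.Nullary using (¬_; does)

-- A binary word: a list over Bool, with false = 0 and true = 1.
Word : Set
Word = List Bool

-- c p w : the number of occurrences of p in w as a (scattered) subword,
-- i.e. the number of index choices i₁ < ⋯ < i_l with w_{i₁}⋯w_{i_l} = p.
-- Standard recursion: either the first letter of w is not used, or it is
-- used as the first letter of p (only possible if the letters agree).
c : Word → Word → ℕ
c []      w        = 1
c (_ ∷ _) []       = 0
c (a ∷ p) (x ∷ w)  = c (a ∷ p) w + (if does (a ≟ᵇ x) then c p w else 0)

words : ℕ → List Word
words zero    = [] ∷ []
words (suc n) = map (false ∷_) (words n) ++ map (true ∷_) (words n)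

B : ℕ → Word → ℕ → ℕ
B n p k = length (filter (λ w → c p w ≟ k) (words n))

InternalZero : ℕ → Word → Set
InternalZero n p =
  ∃[ k₁ ] ∃[ k₂ ] ∃[ k₃ ]
    (k₁ < k₂ × k₂ < k₃ × ¬ (B n p k₁ ≡ 0) × ¬ (B n p k₃ ≡ 0) × B n p k₂ ≡ 0)

w101 : Word
w101 = true ∷ false ∷ true ∷ []

-- A zero of w with b of the c₁ w ones before it lies in b (c₁ w − b) ≤ ⌊(c₁ w)²/4⌋ occurrences
-- of 101, so c₁₀₁ w ≤ c₀ w · ⌊(c₁ w)²/4⌋ ≤ z h² for some h, z with 2h + z = length w.
-- Conversely every k ≤ z h² is attained at length 2h + z, except k = 5 at length 6. If
-- k ≤ (z − 1) h² or k ≤ (z + 2)(h − 1)², recurse on (h, z − 1), prepending a zero, or on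
-- (h − 1, z + 2). Otherwise the deficit d = z h² − k is below h²; split greedily as
-- d = j² + i² + s with s ≤ 2i, it is realised by 1^(h−j) 0 1^(j−1) 0^s 1 0^p 1^i 0 1^(h−i)
-- with s + p + 2 = z. That s ≤ z − 2 follows from the window bounds when i ≥ 5 or z ≥ 10 and
-- is checked by computation otherwise. So for n ≠ 6 the values of c₁₀₁ at length n form an
-- initial segment of ℕ, while at n = 6 exactly the value 5 is missing.

module Submission where

open import Defs
open import Data.Bool using (Bool; true; false; T)
open import Data.Bool.ListAction using (all)
open import Data.Nat
open import Data.Nat.Properties
open import Data.Nat.Tactic.RingSolver using (solve-∀)
open import Data.List using (List; []; _∷_; _++_; length; replicate; upTo; map)
open import Data.List.Membership.Propositional using (_∈_)
open import Data.List.Membership.Propositional.Properties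
  using (∈-upTo⁺; ∈-length; ∈-filter⁺; ∈-filter⁻; ∈-map⁺; ∈-map⁻; ∈-++⁺ˡ; ∈-++⁺ʳ; ∈-++⁻)
open import Data.List.Relation.Unary.All as All using ()
open import Data.List.Relation.Unary.All.Properties using (all⁺)
open import Data.List.Relation.Unary.Any using (here)
open import Data.Product using (_×_; _,_; proj₁; proj₂; ∃-syntax; map₁; map₂)
open import Data.Sum using (_⊎_; inj₁; inj₂)
open import Function using (_∘_; _⇔_; mk⇔)
open import Relation.Nullary using (¬_; yes; no; contradiction; ¬?)
open import Relation.Nullary.Decidable using (Dec; isYes; toWitness; _×-dec_; _→-dec_)
open import Relation.Binary.PropositionalEquality

c₀ c₁ c₀₁ c₁₀₁ : Word → ℕ
c₀   = c (false ∷ [])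
c₁   = c (true ∷ [])
c₀₁  = c (false ∷ true ∷ [])
c₁₀₁ = c w101

infix 6 1^_ 0^_

1^_ 0^_ : ℕ → Word
1^ n = replicate n true
0^ n = replicate n false

length≡c₀+c₁ : ∀ w → length w ≡ c₀ w + c₁ w
length≡c₀+c₁ []          = refl
length≡c₀+c₁ (false ∷ w) =
  trans (cong suc (length≡c₀+c₁ w)) (sym (cong₂ _+_ (+-comm (c₀ w) 1) (+-identityʳ (c₁ w))))
length≡c₀+c₁ (true ∷ w)  =
  trans (cong suc (length≡c₀+c₁ w))
        (sym (trans (cong₂ _+_ (+-identityʳ (c₀ w)) (+-comm (c₁ w) 1)) (+-suc (c₀ w) (c₁ w))))

-- Indices rather than functions of w, so that chaining the lemmas below infers the word.
record Stats (w : Word) (ℓ n₁ n₀₁ n₁₀₁ : ℕ) : Set where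
  constructor stats
  field
    length≡ : length w ≡ ℓ
    c₁≡     : c₁ w ≡ n₁
    c₀₁≡    : c₀₁ w ≡ n₀₁
    c₁₀₁≡   : c₁₀₁ w ≡ n₁₀₁

stats-1∷ : ∀ {w ℓ a b v} → Stats w ℓ a b v → Stats (true ∷ w) (suc ℓ) (suc a) b (v + b)
stats-1∷ (stats l p q r) =
  stats (cong suc l) (trans (+-comm _ 1) (cong suc p)) (trans (+-identityʳ _) q) (cong₂ _+_ r q)

stats-0∷ : ∀ {w ℓ a b v} → Stats w ℓ a b v → Stats (false ∷ w) (suc ℓ) a (b + a) v
stats-0∷ (stats l p q r) =
  stats (cong suc l) (trans (+-identityʳ _) p) (cong₂ _+_ q p) (trans (+-identityʳ _) r)

x+n*y+y≡x+[1+n]*y : ∀ x n y → x + n * y + y ≡ x + suc n * y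
x+n*y+y≡x+[1+n]*y x n y = trans (+-assoc x (n * y) y) (cong (x +_) (+-comm (n * y) y))

stats-1^++ : ∀ n {w ℓ a b v} → Stats w ℓ a b v → Stats (1^ n ++ w) (n + ℓ) (n + a) b (v + n * b)
stats-1^++ zero    (stats l p q r) = stats l p q (trans r (sym (+-identityʳ _)))
stats-1^++ (suc n) {b = b} {v} st with stats l p q r ← stats-1∷ (stats-1^++ n st) =
  stats l p q (trans r (x+n*y+y≡x+[1+n]*y v n b))

stats-0^++ : ∀ n {w ℓ a b v} → Stats w ℓ a b v → Stats (0^ n ++ w) (n + ℓ) a (b + n * a) v
stats-0^++ zero    (stats l p q r) = stats l p (trans q (sym (+-identityʳ _))) r
stats-0^++ (suc n) {a = a} {b} st with stats l p q r ← stats-0∷ (stats-0^++ n st) =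
  stats l p (trans q (x+n*y+y≡x+[1+n]*y b n a)) r

stats-1^ : ∀ n → Stats (1^ n) n n 0 0
stats-1^ zero    = stats refl refl refl refl
stats-1^ (suc n) = stats-1∷ (stats-1^ n)

c₁₀₁-1^++ : ∀ n w → c₁₀₁ (1^ n ++ w) ≡ c₁₀₁ w + n * c₀₁ w
c₁₀₁-1^++ n w = Stats.c₁₀₁≡ (stats-1^++ n (stats refl refl refl refl))

⌊_²/4⌋ : ℕ → ℕ
⌊ m ²/4⌋ = ⌊ m /2⌋ * ⌈ m /2⌉

⌈n/2⌉≡⌊n/2⌋⊎⌈n/2⌉≡1+⌊n/2⌋ : ∀ n → ⌈ n /2⌉ ≡ ⌊ n /2⌋ ⊎ ⌈ n /2⌉ ≡ suc ⌊ n /2⌋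
⌈n/2⌉≡⌊n/2⌋⊎⌈n/2⌉≡1+⌊n/2⌋ zero          = inj₁ refl
⌈n/2⌉≡⌊n/2⌋⊎⌈n/2⌉≡1+⌊n/2⌋ (suc zero)    = inj₂ refl
⌈n/2⌉≡⌊n/2⌋⊎⌈n/2⌉≡1+⌊n/2⌋ (suc (suc n)) with ⌈n/2⌉≡⌊n/2⌋⊎⌈n/2⌉≡1+⌊n/2⌋ n
... | inj₁ eq = inj₁ (cong suc eq)
... | inj₂ eq = inj₂ (cong suc eq)

m≤n⇒m≤⌊[m+n]/2⌋ : ∀ {m n} → m ≤ n → m ≤ ⌊ m + n /2⌋
m≤n⇒m≤⌊[m+n]/2⌋ {m} {n} m≤n =
  subst (_≤ ⌊ m + n /2⌋) (sym (n≡⌊n+n/2⌋ m)) (⌊n/2⌋-mono (+-monoʳ-≤ m m≤n))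

m≤n⇒m*n≤⌊[m+n]²/4⌋ : ∀ {m n} → m ≤ n → m * n ≤ ⌊ m + n ²/4⌋
m≤n⇒m*n≤⌊[m+n]²/4⌋ {m} {n} m≤n
  with m≤a ← m≤n⇒m≤⌊[m+n]/2⌋ m≤n
  with e , m+e≡a ← m≤n⇒∃[o]m+o≡n m≤a
     | f , m+f≡b ← m≤n⇒∃[o]m+o≡n (≤-trans m≤a (⌊n/2⌋≤⌈n/2⌉ (m + n)))
  = begin
    m * n                      ≡⟨ cong (m *_) n≡e+[m+f] ⟩
    m * (e + (m + f))          ≤⟨ m≤m+n _ (e * f) ⟩
    m * (e + (m + f)) + e * f  ≡⟨ expand m e f ⟩
    (m + e) * (m + f)          ≡⟨ cong₂ _*_ m+e≡a m+f≡b ⟩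
    ⌊ m + n ²/4⌋               ∎
  where
  open ≤-Reasoning
  n≡e+[m+f] : n ≡ e + (m + f)
  n≡e+[m+f] = +-cancelˡ-≡ m _ _ (begin-equality
    m + n                       ≡⟨ sym (⌊n/2⌋+⌈n/2⌉≡n (m + n)) ⟩
    ⌊ m + n /2⌋ + ⌈ m + n /2⌉   ≡⟨ cong₂ _+_ (sym m+e≡a) (sym m+f≡b) ⟩
    m + e + (m + f)             ≡⟨ +-assoc m e (m + f) ⟩
    m + (e + (m + f))           ∎)
  expand : ∀ m e f → m * (e + (m + f)) + e * f ≡ (m + e) * (m + f)
  expand = solve-∀

m*n≤⌊[m+n]²/4⌋ : ∀ m n → m * n ≤ ⌊ m + n ²/4⌋
m*n≤⌊[m+n]²/4⌋ m n with ≤-total m n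
... | inj₁ m≤n = m≤n⇒m*n≤⌊[m+n]²/4⌋ m≤n
... | inj₂ n≤m = subst₂ _≤_ (*-comm n m) (cong ⌊_²/4⌋ (+-comm n m)) (m≤n⇒m*n≤⌊[m+n]²/4⌋ n≤m)

1^++1∷ : ∀ t w → 1^ t ++ true ∷ w ≡ 1^ suc t ++ w
1^++1∷ zero    w = refl
1^++1∷ (suc t) w = cong (true ∷_) (1^++1∷ t w)

-- A zero in front of w lies in t · c₁ w of the new occurrences.
c₁₀₁[1^++]≤c₀*⌊[t+c₁]²/4⌋ : ∀ t w → c₁₀₁ (1^ t ++ w) ≤ c₀ w * ⌊ t + c₁ w ²/4⌋
c₁₀₁[1^++]≤c₀*⌊[t+c₁]²/4⌋ t [] = ≤-reflexive (trans (c₁₀₁-1^++ t []) (*-zeroʳ t))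
c₁₀₁[1^++]≤c₀*⌊[t+c₁]²/4⌋ t (true ∷ w) =
  subst₂ _≤_ (cong c₁₀₁ (sym (1^++1∷ t w)))
             (cong₂ (λ x y → x * ⌊ y ²/4⌋) (sym (+-identityʳ (c₀ w)))
                    (sym (trans (cong (t +_) (+-comm (c₁ w) 1)) (+-suc t (c₁ w)))))
             (c₁₀₁[1^++]≤c₀*⌊[t+c₁]²/4⌋ (suc t) w)
c₁₀₁[1^++]≤c₀*⌊[t+c₁]²/4⌋ t (false ∷ w) = begin
  c₁₀₁ (1^ t ++ false ∷ w)                   ≡⟨ c₁₀₁-1^++ t (false ∷ w) ⟩
  c₁₀₁ w + 0 + t * (c₀₁ w + c₁ w)            ≡⟨ regroup (c₁₀₁ w) (c₀₁ w) (c₁ w) t ⟩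
  c₁₀₁ w + t * c₀₁ w + t * c₁ w              ≡⟨ cong (_+ t * c₁ w) (sym (c₁₀₁-1^++ t w)) ⟩
  c₁₀₁ (1^ t ++ w) + t * c₁ w                ≤⟨ +-mono-≤ (c₁₀₁[1^++]≤c₀*⌊[t+c₁]²/4⌋ t w)
                                                          (m*n≤⌊[m+n]²/4⌋ t (c₁ w)) ⟩
  c₀ w * ⌊ t + c₁ w ²/4⌋ + ⌊ t + c₁ w ²/4⌋   ≡⟨ x*q+q≡[x+1]*q (c₀ w) _ ⟩
  (c₀ w + 1) * ⌊ t + c₁ w ²/4⌋               ≡⟨ cong (λ y → (c₀ w + 1) * ⌊ t + y ²/4⌋)
                                                     (sym (+-identityʳ (c₁ w))) ⟩
  (c₀ w + 1) * ⌊ t + (c₁ w + 0) ²/4⌋         ∎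
  where
  open ≤-Reasoning
  regroup : ∀ x y z t → x + 0 + t * (y + z) ≡ x + t * y + t * z
  regroup = solve-∀
  x*q+q≡[x+1]*q : ∀ x q → x * q + q ≡ (x + 1) * q
  x*q+q≡[x+1]*q = solve-∀

c₁₀₁≤c₀*⌊c₁²/4⌋ : ∀ w → c₁₀₁ w ≤ c₀ w * ⌊ c₁ w ²/4⌋
c₁₀₁≤c₀*⌊c₁²/4⌋ = c₁₀₁[1^++]≤c₀*⌊[t+c₁]²/4⌋ 0

SquareBounded : ℕ → ℕ → Set
SquareBounded n k = ∃[ h ] ∃[ z ] h + h + z ≡ n × k ≤ z * (h * h)

squareBounded-≤ : ∀ {n k k′} → k ≤ k′ → SquareBounded n k′ → SquareBounded n k
squareBounded-≤ k≤k′ (h , z , n≡ , k′≤) = h , z , n≡ , ≤-trans k≤k′ k′≤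

squareBounded-odd : ∀ z a → SquareBounded (a + suc a + z) (z * (a * suc a))
squareBounded-odd z a with z ≤? a
... | yes z≤a = a , suc z , shift z a , (begin
  z * (a * suc a)       ≡⟨ split z a ⟩
  z * (a * a) + z * a   ≤⟨ +-monoʳ-≤ (z * (a * a)) (*-monoˡ-≤ a z≤a) ⟩
  z * (a * a) + a * a   ≡⟨ +-comm (z * (a * a)) (a * a) ⟩
  suc z * (a * a)       ∎)
  where
  open ≤-Reasoning
  shift : ∀ z a → a + a + suc z ≡ a + suc a + z
  shift = solve-∀
  split : ∀ z a → z * (a * suc a) ≡ z * (a * a) + z * a
  split = solve-∀
squareBounded-odd zero    a | no z≰a = contradiction z≤n z≰a
squareBounded-odd (suc y) a | no z≰a = suc a , y , shift y a , (begin
  suc y * (a * suc a)            ≡⟨⟩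
  a * suc a + y * (a * suc a)    ≤⟨ +-monoˡ-≤ _ (*-monoˡ-≤ (suc a) (≤-pred (≰⇒> z≰a))) ⟩
  y * suc a + y * (a * suc a)    ≡⟨ merge y a ⟩
  y * (suc a * suc a)            ∎)
  where
  open ≤-Reasoning
  shift : ∀ y a → suc a + suc a + y ≡ a + suc a + suc y
  shift = solve-∀
  merge : ∀ y a → y * suc a + y * (a * suc a) ≡ y * (suc a * suc a)
  merge = solve-∀

squareBounded-product : ∀ z a b → b ≡ a ⊎ b ≡ suc a → SquareBounded (a + b + z) (z * (a * b))
squareBounded-product z a .a       (inj₁ refl) = a , z , refl , ≤-refl
squareBounded-product z a .(suc a) (inj₂ refl) = squareBounded-odd z a

c₁₀₁-squareBounded : ∀ w → SquareBounded (length w) (c₁₀₁ w)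
c₁₀₁-squareBounded w
  with h , z , n≡ , k≤ ← squareBounded-product (c₀ w) ⌊ c₁ w /2⌋ ⌈ c₁ w /2⌉ (⌈n/2⌉≡⌊n/2⌋⊎⌈n/2⌉≡1+⌊n/2⌋ (c₁ w))
  = h , z , trans n≡ (sym length≡) , ≤-trans (c₁₀₁≤c₀*⌊c₁²/4⌋ w) k≤
  where
  length≡ : length w ≡ ⌊ c₁ w /2⌋ + ⌈ c₁ w /2⌉ + c₀ w
  length≡ = trans (length≡c₀+c₁ w)
                  (trans (+-comm (c₀ w) (c₁ w)) (cong (_+ c₀ w) (sym (⌊n/2⌋+⌈n/2⌉≡n (c₁ w)))))

-- Counting up from 0 keeps ⌊√_⌋ cheap to normalise, which remainderFits-small relies on.
sqrtSearch : ℕ → ℕ → ℕ → ℕ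
sqrtSearch n zero    j = j
sqrtSearch n (suc k) j with suc j * suc j ≤? n
... | yes _ = sqrtSearch n k (suc j)
... | no  _ = j

⌊√_⌋ : ℕ → ℕ
⌊√ n ⌋ = sqrtSearch n n 0

sqrtSearch-bounds : ∀ n k j → j * j ≤ n → n < (j + suc k) * (j + suc k) →
  let r = sqrtSearch n k j in r * r ≤ n × n < suc r * suc r
sqrtSearch-bounds n zero    j j²≤n n<[j+1]² = j²≤n , subst (λ x → n < x * x) (+-comm j 1) n<[j+1]²
sqrtSearch-bounds n (suc k) j j²≤n n<[j+k+2]² with suc j * suc j ≤? n
... | yes [j+1]²≤n =
  sqrtSearch-bounds n k (suc j) [j+1]²≤n (subst (λ x → n < x * x) (+-suc j (suc k)) n<[j+k+2]²)
... | no  [j+1]²≰n = j²≤n , ≰⇒> [j+1]²≰n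

⌊√n⌋²≤n : ∀ n → ⌊√ n ⌋ * ⌊√ n ⌋ ≤ n
⌊√n⌋²≤n n = proj₁ (sqrtSearch-bounds n n 0 z≤n (s≤s (m≤m+n n (n * suc n))))

n<[1+⌊√n⌋]² : ∀ n → n < suc ⌊√ n ⌋ * suc ⌊√ n ⌋
n<[1+⌊√n⌋]² n = proj₂ (sqrtSearch-bounds n n 0 z≤n (s≤s (m≤m+n n (n * suc n))))

m*m<n*n⇒m<n : ∀ {m n} → m * m < n * n → m < n
m*m<n*n⇒m<n {m} {n} m²<n² with n ≤? m
... | yes n≤m = contradiction (*-mono-≤ n≤m n≤m) (<⇒≱ m²<n²)
... | no  n≰m = ≰⇒> n≰m

⌊√n⌋<m : ∀ {n m} → n < m * m → ⌊√ n ⌋ < m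
⌊√n⌋<m {n} n<m² = m*m<n*n⇒m<n (≤-<-trans (⌊√n⌋²≤n n) n<m²)

1≤⌊√n⌋ : ∀ {n} → 1 ≤ n → 1 ≤ ⌊√ n ⌋
1≤⌊√n⌋ {n} 1≤n with ⌊√ n ⌋ | n<[1+⌊√n⌋]² n
... | zero  | n<1 = contradiction (n<1⇒n≡0 n<1) (m<n⇒n≢0 1≤n)
... | suc _ | _   = s≤s z≤n

sqrtRem : ℕ → ℕ
sqrtRem n = n ∸ ⌊√ n ⌋ * ⌊√ n ⌋

⌊√n⌋²+sqrtRem≡n : ∀ n → ⌊√ n ⌋ * ⌊√ n ⌋ + sqrtRem n ≡ n
⌊√n⌋²+sqrtRem≡n n = m+[n∸m]≡n (⌊√n⌋²≤n n)

sqrtRem≤2*⌊√n⌋ : ∀ n → sqrtRem n ≤ 2 * ⌊√ n ⌋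
sqrtRem≤2*⌊√n⌋ n = ≤-pred (+-cancelˡ-< (r * r) (sqrtRem n) (suc (2 * r)) (begin-strict
  r * r + sqrtRem n    ≡⟨ ⌊√n⌋²+sqrtRem≡n n ⟩
  n                    <⟨ n<[1+⌊√n⌋]² n ⟩
  suc r * suc r        ≡⟨ square-suc r ⟩
  r * r + suc (2 * r)  ∎))
  where
  open ≤-Reasoning
  r = ⌊√ n ⌋
  square-suc : ∀ r → suc r * suc r ≡ r * r + suc (2 * r)
  square-suc = solve-∀

[z+2]g²<z[1+g]²⇒g≤z : ∀ g z → (z + 2) * (g * g) < z * (suc g * suc g) → g ≤ z
[z+2]g²<z[1+g]²⇒g≤z g z window with g ≤? z
... | yes g≤z = g≤z
... | no  g≰z with e , refl ← m≤n⇒∃[o]m+o≡n (≰⇒> g≰z) =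
  contradiction (m≤m+n _ _) (<⇒≱ (subst (_< z * (suc (suc z + e) * suc (suc z + e))) (gap z e) window))
  where
  gap : ∀ z e → (z + 2) * ((suc z + e) * (suc z + e))
              ≡ z * (suc (suc z + e) * suc (suc z + e)) + (z + 2 + 2 * e + 2 * e * (z + 1 + e))
  gap = solve-∀

i*i≤2*g⇒2+2*i≤g : ∀ {i g} → 5 ≤ i → i * i ≤ 2 * g → 2 + 2 * i ≤ g
i*i≤2*g⇒2+2*i≤g {i} {g} 5≤i i²≤2g = *-cancelˡ-≤ 2 (begin
  2 * (2 + 2 * i)  ≡⟨ double i ⟩
  4 + 4 * i        ≤⟨ +-monoˡ-≤ (4 * i) (≤-trans (n≤1+n 4) 5≤i) ⟩
  i + 4 * i        ≤⟨ *-monoˡ-≤ i 5≤i ⟩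
  i * i            ≤⟨ i²≤2g ⟩
  2 * g            ∎)
  where
  open ≤-Reasoning
  double : ∀ i → 2 * (2 + 2 * i) ≡ 4 + 4 * i
  double = solve-∀

-- (g, z, d) = (1, 2, 3) is the deficit of length 6 and value 5.
RemainderFits : ℕ → ℕ → ℕ → Set
RemainderFits g z d =
  1 ≤ d → d + (z + 2) * (g * g) < z * (suc g * suc g) → ¬ (g ≡ 1 × z ≡ 2 × d ≡ 3) →
  2 + sqrtRem (sqrtRem d) ≤ z

remainderFits? : ∀ g z d → Dec (RemainderFits g z d)
remainderFits? g z d =
  1 ≤? d →-dec _ <? _ →-dec ¬? (g ≟ 1 ×-dec z ≟ 2 ×-dec d ≟ 3) →-dec _ ≤? z

T-all-upTo : ∀ p n → T (all p (upTo n)) → ∀ {m} → m < n → T (p m)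
T-all-upTo p n all-p m<n = All.lookup (all⁺ p (upTo n) all-p) (∈-upTo⁺ m<n)

remainderFits-small : ∀ {g z d} → g < 10 → z < 10 → d < suc g * suc g → RemainderFits g z d
remainderFits-small {g} {z} {d} g<10 z<10 d<h² =
  toWitness {a? = remainderFits? g z d}
    (T-all-upTo (fits g z) _ (T-all-upTo (fitsAll g) 10 (T-all-upTo fitsAll² 10 check g<10) z<10) d<h²)
  where
  fits : ℕ → ℕ → ℕ → Bool
  fits g z d = isYes (remainderFits? g z d)
  fitsAll : ℕ → ℕ → Bool
  fitsAll g z = all (fits g z) (upTo (suc g * suc g))
  fitsAll² : ℕ → Bool
  fitsAll² g = all (fitsAll g) (upTo 10)
  check : T (all fitsAll² (upTo 10))
  check = _

remainderFits : ∀ g z d → d < suc g * suc g → RemainderFits g z d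
remainderFits g z d d<h² 1≤d window exc = fits (5 ≤? i) (10 ≤? z)
  where
  open ≤-Reasoning
  j = ⌊√ d ⌋
  r = sqrtRem d
  i = ⌊√ r ⌋
  s = sqrtRem r
  g≤z : g ≤ z
  g≤z = [z+2]g²<z[1+g]²⇒g≤z g z (≤-<-trans (m≤n+m _ d) window)
  fits : Dec (5 ≤ i) → Dec (10 ≤ z) → 2 + s ≤ z
  fits (yes 5≤i) _ = begin
    2 + s      ≤⟨ +-monoʳ-≤ 2 (sqrtRem≤2*⌊√n⌋ r) ⟩
    2 + 2 * i  ≤⟨ i*i≤2*g⇒2+2*i≤g 5≤i i²≤2g ⟩
    g          ≤⟨ g≤z ⟩
    z          ∎
    where
    i²≤2g : i * i ≤ 2 * g
    i²≤2g = begin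
      i * i    ≤⟨ ⌊√n⌋²≤n r ⟩
      r        ≤⟨ sqrtRem≤2*⌊√n⌋ d ⟩
      2 * j    ≤⟨ *-monoʳ-≤ 2 (≤-pred (⌊√n⌋<m {m = suc g} d<h²)) ⟩
      2 * g    ∎
  fits (no 5≰i) (yes 10≤z) = begin
    2 + s      ≤⟨ +-monoʳ-≤ 2 (sqrtRem≤2*⌊√n⌋ r) ⟩
    2 + 2 * i  ≤⟨ +-monoʳ-≤ 2 (*-monoʳ-≤ 2 (≤-pred (≰⇒> 5≰i))) ⟩
    10         ≤⟨ 10≤z ⟩
    z          ∎
  fits (no _) (no 10≰z) = remainderFits-small (≤-<-trans g≤z (≰⇒> 10≰z)) (≰⇒> 10≰z) d<h² 1≤d window exc

Attainable : ℕ → Word → ℕ → Set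
Attainable n p k = ∃[ w ] length w ≡ n × c p w ≡ k

attainable-0∷ : ∀ {n k} → Attainable n w101 k → Attainable (suc n) w101 k
attainable-0∷ (w , len , val) = false ∷ w , cong suc len , trans (+-identityʳ _) val

-- (7, 5) cannot come from the unattainable (6, 5); the word 1011111 attains it.
attainable-suc : ∀ {n k} → (¬ (n ≡ 6 × k ≡ 5) → Attainable n w101 k) → Attainable (suc n) w101 k
attainable-suc {n} {k} attainable with (n ≟ 6) ×-dec (k ≟ 5)
... | yes (refl , refl) = true ∷ false ∷ 1^ 5 , refl , refl
... | no  ¬6,5          = attainable-0∷ (attainable ¬6,5)

sandwich-attains : ∀ h z → Attainable (h + h + z) w101 (z * (h * h))
sandwich-attains h z with stats ℓ≡ _ _ c₁₀₁≡ ← stats-1^++ h (stats-0^++ z (stats-1^ h)) =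
  1^ h ++ 0^ z ++ 1^ h , trans ℓ≡ (length-identity h z) , trans c₁₀₁≡ (value-identity h z)
  where
  length-identity : ∀ h z → h + (z + h) ≡ h + h + z
  length-identity = solve-∀
  value-identity : ∀ h z → h * (z * h) ≡ z * (h * h)
  value-identity = solve-∀

zeros-attain : ∀ n → Attainable n w101 0
zeros-attain n = subst (Attainable n w101) (*-zeroʳ n) (sandwich-attains 0 n)

deficitWord-attains : ∀ {h j i} s p → 1 ≤ j → j ≤ h → i ≤ h →
  ∃[ w ] length w ≡ h + h + (2 + s + p) × c₁₀₁ w + (j * j + i * i + s) ≡ (2 + s + p) * (h * h)
deficitWord-attains {j = suc J} {i} s p (s≤s z≤n) j≤h i≤h
  with a , refl ← m≤n⇒∃[o]m+o≡n j≤h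
     | c , i+c≡h ← m≤n⇒∃[o]m+o≡n i≤h
  with stats ℓ≡ _ _ c₁₀₁≡ ← stats-1^++ a (stats-0∷ (stats-1^++ J (stats-0^++ s
                              (stats-1∷ (stats-0^++ p (stats-1^++ i (stats-0∷ (stats-1^ c))))))))
  = w , trans ℓ≡ length≡ , value≡
  where
  w = 1^ a ++ false ∷ 1^ J ++ 0^ s ++ true ∷ 0^ p ++ 1^ i ++ false ∷ 1^ c
  j = suc J
  h = j + a
  Z = 2 + s + p
  length≡ : a + suc (J + (s + suc (p + (i + suc c)))) ≡ h + h + Z
  length≡ = trans (regroup a J s p i c) (cong (λ x → h + x + Z) i+c≡h)
    where
    regroup : ∀ a J s p i c → a + suc (J + (s + suc (p + (i + suc c)))) ≡ (suc J + a) + (i + c) + (2 + s + p)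
    regroup = solve-∀
  -- Here h = j + a counts the ones left of the block 0^s 1 0^p and i + c those right of it;
  -- kept apart, the value of w is a polynomial identity.
  value≡unbalanced : c₁₀₁ w + (j * j + i * i + s) + ((j + s) * (i + c) + i * h)
                     ≡ Z * (h * (i + c)) + ((j + s) * h + i * (i + c))
  value≡unbalanced =
    trans (cong (λ v → v + (j * j + i * i + s) + ((j + s) * (i + c) + i * h)) c₁₀₁≡) (identity a J s p i c)
    where
    identity : ∀ a J s p i c →
      i * c + (c + p * (i + c)) + J * (c + p * (i + c) + s * suc (i + c))
        + a * (c + p * (i + c) + s * suc (i + c) + (J + suc (i + c)))
        + (suc J * suc J + i * i + s) + ((suc J + s) * (i + c) + i * (suc J + a))
      ≡ (2 + s + p) * ((suc J + a) * (i + c)) + ((suc J + s) * (suc J + a) + i * (i + c))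
    identity = solve-∀
  value≡ : c₁₀₁ w + (j * j + i * i + s) ≡ Z * (h * h)
  value≡ = +-cancelʳ-≡ ((j + s) * h + i * h) _ _
    (subst (λ x → c₁₀₁ w + (j * j + i * i + s) + ((j + s) * x + i * h) ≡ Z * (h * x) + ((j + s) * h + i * x))
           i+c≡h value≡unbalanced)

deficit-attains : ∀ g z d → d < suc g * suc g → d + (z + 2) * (g * g) < z * (suc g * suc g) →
  ¬ (g ≡ 1 × z ≡ 2 × d ≡ 3) → ∃[ w ] length w ≡ suc g + suc g + z × c₁₀₁ w + d ≡ z * (suc g * suc g)
deficit-attains g z zero _ _ _ = map₂ (map₂ (λ val → trans (+-identityʳ _) val)) (sandwich-attains (suc g) z)
deficit-attains g z d@(suc _) d<h² window exc =
  attains (deficitWord-attains s p (1≤⌊√n⌋ {d} (s≤s z≤n)) j≤h i≤h)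
  where
  h = suc g
  j = ⌊√ d ⌋
  i = ⌊√ sqrtRem d ⌋
  s = sqrtRem (sqrtRem d)
  p = z ∸ (2 + s)
  j≤h : j ≤ h
  j≤h = <⇒≤ (⌊√n⌋<m {m = h} d<h²)
  i≤h : i ≤ h
  i≤h = <⇒≤ (⌊√n⌋<m {m = h} (≤-<-trans (m∸n≤m d (j * j)) d<h²))
  Z≡z : 2 + s + p ≡ z
  Z≡z = m+[n∸m]≡n (remainderFits g z d d<h² (s≤s z≤n) window exc)
  d≡ : d ≡ j * j + i * i + s
  d≡ = begin
    d                          ≡⟨ sym (⌊√n⌋²+sqrtRem≡n d) ⟩
    j * j + sqrtRem d          ≡⟨ cong (j * j +_) (sym (⌊√n⌋²+sqrtRem≡n (sqrtRem d))) ⟩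
    j * j + (i * i + s)        ≡⟨ sym (+-assoc (j * j) (i * i) s) ⟩
    j * j + i * i + s          ∎
    where open ≡-Reasoning
  attains : ∃[ w ] length w ≡ h + h + (2 + s + p) × c₁₀₁ w + (j * j + i * i + s) ≡ (2 + s + p) * (h * h) →
            ∃[ w ] length w ≡ h + h + z × c₁₀₁ w + d ≡ z * (h * h)
  attains (w , len , val) =
    w , trans len (cong (h + h +_) Z≡z) ,
    trans (cong (c₁₀₁ w +_) d≡) (trans val (cong (_* (h * h)) Z≡z))

window-attains : ∀ g z {k} → k ≤ suc z * (suc g * suc g) → z * (suc g * suc g) < k →
  (suc z + 2) * (g * g) < k → ¬ (suc g + suc g + suc z ≡ 6 × k ≡ 5) →
  Attainable (suc g + suc g + suc z) w101 k
window-attains g z {k} k≤ zH<k [z+3]g²<k exc =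
  attains (deficit-attains g (suc z) d d<H window exc′)
  where
  open ≤-Reasoning
  H = suc g * suc g
  d = suc z * H ∸ k
  d+k≡ : d + k ≡ suc z * H
  d+k≡ = m∸n+n≡m k≤
  d<H : d < H
  d<H = +-cancelʳ-< k d H (begin-strict
    d + k       ≡⟨ d+k≡ ⟩
    H + z * H   <⟨ +-monoʳ-< H zH<k ⟩
    H + k       ∎)
  window : d + (suc z + 2) * (g * g) < suc z * H
  window = begin-strict
    d + (suc z + 2) * (g * g)  <⟨ +-monoʳ-< d [z+3]g²<k ⟩
    d + k                      ≡⟨ d+k≡ ⟩
    suc z * H                  ∎
  exc′ : ¬ (g ≡ 1 × suc z ≡ 2 × d ≡ 3)
  exc′ (g≡1 , z+1≡2 , d≡3) =
    exc (cong₂ (λ a b → suc a + suc a + b) g≡1 z+1≡2 , +-cancelˡ-≡ 3 k 5 (begin-equality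
      3 + k                   ≡⟨ cong (_+ k) (sym d≡3) ⟩
      d + k                   ≡⟨ d+k≡ ⟩
      suc z * (suc g * suc g) ≡⟨ cong₂ (λ a b → a * (suc b * suc b)) z+1≡2 g≡1 ⟩
      8                       ∎))
  attains : ∃[ w ] length w ≡ suc g + suc g + suc z × c₁₀₁ w + d ≡ suc z * H →
            Attainable (suc g + suc g + suc z) w101 k
  attains (w , len , val) = w , len , +-cancelʳ-≡ d (c₁₀₁ w) k (trans val (trans (sym d+k≡) (+-comm d k)))

Coverage : ℕ → Set
Coverage h = ∀ z {k} → k ≤ z * (h * h) → ¬ (h + h + z ≡ 6 × k ≡ 5) → Attainable (h + h + z) w101 k

coverage-0 : Coverage 0
coverage-0 z k≤ _ =
  subst (Attainable z w101) (sym (n≤0⇒n≡0 (≤-trans k≤ (≤-reflexive (*-zeroʳ z))))) (zeros-attain z)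

coverage-suc : ∀ g → Coverage g → Coverage (suc g)
coverage-suc g _          zero    k≤ _ = subst (Attainable _ w101) (sym (n≤0⇒n≡0 k≤)) (zeros-attain _)
coverage-suc g coverage-g (suc z) {k} k≤ exc with k ≤? z * (suc g * suc g)
... | yes k≤zH = subst (λ n → Attainable n w101 k) (sym (+-suc (suc g + suc g) z))
                       (attainable-suc (coverage-suc g coverage-g z k≤zH))
... | no  k≰zH with k ≤? (suc z + 2) * (g * g)
...   | yes k≤[z+3]g² = subst (λ n → Attainable n w101 k) n≡
                              (coverage-g (suc z + 2) k≤[z+3]g² (exc ∘ map₁ (trans (sym n≡))))
  where
  n≡ : g + g + (suc z + 2) ≡ suc g + suc g + suc z
  n≡ = shift g z
    where
    shift : ∀ g z → g + g + (suc z + 2) ≡ suc g + suc g + suc z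
    shift = solve-∀
...   | no  k≰[z+3]g² = window-attains g z k≤ (≰⇒> k≰zH) (≰⇒> k≰[z+3]g²) exc

coverage : ∀ h → Coverage h
coverage zero    = coverage-0
coverage (suc g) = coverage-suc g (coverage g)

attainable-downClosed : ∀ {n k k′} → n ≢ 6 → k ≤ k′ → Attainable n w101 k′ → Attainable n w101 k
attainable-downClosed n≢6 k≤k′ (w , refl , refl)
  with h , z , n≡ , k≤ ← squareBounded-≤ k≤k′ (c₁₀₁-squareBounded w)
  = subst (λ n → Attainable n w101 _) n≡ (coverage h z k≤ (n≢6 ∘ trans (sym n≡) ∘ proj₁))

∈-words : ∀ w → w ∈ words (length w)
∈-words []          = here refl
∈-words (false ∷ w) = ∈-++⁺ˡ (∈-map⁺ (false ∷_) (∈-words w))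
∈-words (true ∷ w)  = ∈-++⁺ʳ (map (false ∷_) (words (length w))) (∈-map⁺ (true ∷_) (∈-words w))

∈-words⇒length≡ : ∀ n {w} → w ∈ words n → length w ≡ n
∈-words⇒length≡ zero    (here refl) = refl
∈-words⇒length≡ (suc n) w∈ with ∈-++⁻ (map (false ∷_) (words n)) w∈
... | inj₁ w∈₀ with v , v∈ , refl ← ∈-map⁻ (false ∷_) w∈₀ = cong suc (∈-words⇒length≡ n v∈)
... | inj₂ w∈₁ with v , v∈ , refl ← ∈-map⁻ (true ∷_) w∈₁  = cong suc (∈-words⇒length≡ n v∈)

length≢0⇒∃∈ : ∀ {A : Set} {xs : List A} → length xs ≢ 0 → ∃[ x ] x ∈ xs
length≢0⇒∃∈ {xs = []}    length≢0 = contradiction refl length≢0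
length≢0⇒∃∈ {xs = x ∷ _} _        = x , here refl

attainable⇒B≢0 : ∀ {n p k} → Attainable n p k → B n p k ≢ 0
attainable⇒B≢0 {p = p} {k} (w , refl , c≡k) =
  m<n⇒n≢0 (∈-length (∈-filter⁺ (λ w → c p w ≟ k) (∈-words w) c≡k))

B≢0⇒attainable : ∀ {n p k} → B n p k ≢ 0 → Attainable n p k
B≢0⇒attainable {n} {p} {k} B≢0
  with w , w∈ ← length≢0⇒∃∈ B≢0
  with w∈words , c≡k ← ∈-filter⁻ (λ w → c p w ≟ k) w∈
  = w , ∈-words⇒length≡ n w∈words , c≡k

internalZero-6 : InternalZero 6 w101
internalZero-6 = 4 , 5 , 6 , ≤-refl , ≤-refl , (λ ()) , (λ ()) , refl

internalZero⇒≡6 : ∀ {n} → InternalZero n w101 → n ≡ 6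
internalZero⇒≡6 {n} (_ , _ , _ , _ , k₂<k₃ , _ , B₃≢0 , B₂≡0) with n ≟ 6
... | yes n≡6 = n≡6
... | no  n≢6 =
  contradiction B₂≡0
    (attainable⇒B≢0 {p = w101} (attainable-downClosed n≢6 (<⇒≤ k₂<k₃) (B≢0⇒attainable {p = w101} B₃≢0)))

mainTheorem15 : (n : ℕ) → InternalZero n w101 ⇔ (n ≡ 6)
mainTheorem15 n = mk⇔ internalZero⇒≡6 λ { refl → internalZero-6 }
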